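{- Let $\mathcal{M}=(V,\mathcal{I})$ be a matroid and $x=\sum_{i=1}^t\beta_i\mathbf{1}_{B_i}$ a convex combination of characteristic vectors of bases $B_1,\dots,B_t$ of $\mathcal{M}$. Let $C$ be a directed cycle in $D_{\mathcal{M}}(B_1,B_2)$ traversing $u_0,v_0,\dots,u_{l-1},v_{l-1}$ in order, with $u_i\in B_1\setminus B_2$, $v_i\in B_2\setminus B_1$, $u_l=u_0$. Obtain $B_1',B_2'$ randomly as follows: with probability $\frac{\beta_2}{\beta_1+\beta_2}$, choose $i$ uniformly from $\{0,\dots,l-1\}$ and set $B_1'=B_1\cup\{v_i\}\setminus\{u_i\}$, $B_2'=B_2$; otherwise choose $i$ uniformly from $\{0,\dots,l-1\}$ and set $B_1'=B_1$, $B_2'=B_2\cup\{u_{i+1}\}\setminus\{v_i\}$. Let $B_i'=B_i$ for $i\in\{3,\dots,t\}$ and $x'=\sum_{i=1}^t\beta_i\mathbf{1}_{B_i'}$. Then $\mathbb{E}[F(x')]\ge F(x)$ for every function $F$ that is the multilinear extension of some submodular function $f\colon 2^V\to\mathbb{R}$.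
   Context: $D_{\mathcal{M}}(B_1,B_2)$ is the bipartite directed graph with vertex set $B_1\triangle B_2$ and edges $(u,v)$ for $u\in B_1\setminus B_2$, $v\in B_2\setminus B_1$ with $B_1\cup\{v\}\setminus\{u\}\in\mathcal{I}$, and edges $(v,u)$ for $u\in B_1\setminus B_2$, $v\in B_2\setminus B_1$ with $B_2\cup\{u\}\setminus\{v\}\in\mathcal{I}$. The multilinear extension of $f$ is $F(x)=\sum_{S\subseteq V}f(S)\prod_{v\in S}x_v\prod_{v\notin S}(1-x_v)$ for $x\in[0,1]^V$. $\mathbf{1}_A$ is the characteristic vector of $A$. -}

module Defs where

open import Level using (Level; _⊔_) renaming (suc to lsuc)
open import Data.Nat as ℕ using (ℕ; zero; suc)
open import Data.Nat.DivMod using (_mod_)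
open import Data.Bool using (Bool; true; false; if_then_else_)
open import Data.Fin using (Fin; zero; suc; toℕ)
open import Data.Fin.Subset using (Subset; _∈_; _∉_; _⊆_; _∪_; _∩_; _-_; ⁅_⁆; ∣_∣; outside; inside)
open import Data.Vec using (Vec; []; _∷_)
open import Data.List using (List; []; _∷_; map; _++_; foldr)
open import Data.Product using (Σ; ∃; _×_; _,_)
open import Function.Definitions using (Injective)
open import Relation.Binary.PropositionalEquality using (_≡_)
open import Relation.Binary.Structures using (IsTotalOrder)
open import Relation.Nullary using (¬_)
open import Algebra.Structures using (IsCommutativeRing)

-- The statement is quantified over every ordered field, so in
-- particular it covers ℝ.  Equality is propositional; the inverse is
-- a total function, only specified on nonzero elements.

record OrderedField (c ℓ : Level) : Set (lsuc (c ⊔ ℓ)) where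
  infixl 7 _*_
  infixl 6 _+_ _-ᶠ_
  infix  4 _≤_
  field
    Carrier : Set c
    _+_ _*_ : Carrier → Carrier → Carrier
    -_      : Carrier → Carrier
    0# 1#   : Carrier
    _⁻¹     : Carrier → Carrier
    _≤_     : Carrier → Carrier → Set ℓ
    isCommutativeRing : IsCommutativeRing _≡_ _+_ _*_ -_ 0# 1#
    ⁻¹-inverse : ∀ x → ¬ (x ≡ 0#) → x * (x ⁻¹) ≡ 1#
    0≢1 : ¬ (0# ≡ 1#)
    isTotalOrder : IsTotalOrder _≡_ _≤_
    +-mono-≤ : ∀ {x y} z → x ≤ y → x + z ≤ y + z
    *-nonneg : ∀ {x y} → 0# ≤ x → 0# ≤ y → 0# ≤ x * y

  _-ᶠ_ : Carrier → Carrier → Carrier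
  x -ᶠ y = x + (- y)

  _÷_ : Carrier → Carrier → Carrier
  x ÷ y = x * (y ⁻¹)

  fromℕ : ℕ → Carrier
  fromℕ zero    = 0#
  fromℕ (suc k) = 1# + fromℕ k

  sumList : List Carrier → Carrier
  sumList = foldr _+_ 0#

  sumFin : (m : ℕ) → (Fin m → Carrier) → Carrier
  sumFin zero    g = 0#
  sumFin (suc m) g = g zero + sumFin m (λ i → g (suc i))

  prodFin : (m : ℕ) → (Fin m → Carrier) → Carrier
  prodFin zero    g = 1#
  prodFin (suc m) g = g zero * prodFin m (λ i → g (suc i))

allSubsets : (n : ℕ) → List (Subset n)
allSubsets zero    = [] ∷ []
allSubsets (suc n) =
  map (outside ∷_) (allSubsets n) ++ map (inside ∷_) (allSubsets n)

swap : ∀ {n} → Subset n → Fin n → Fin n → Subset n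
swap B a b = (B ∪ ⁅ a ⁆) - b

record Matroid (n : ℕ) : Set₁ where
  field
    Indep        : Subset n → Set
    indep-empty  : Indep (Data.Fin.Subset.⊥)
    indep-down   : ∀ {I J} → I ⊆ J → Indep J → Indep I
    indep-exch   : ∀ {I J} → Indep I → Indep J → ∣ I ∣ ℕ.< ∣ J ∣ →
                   ∃ λ e → e ∈ J × e ∉ I × Indep (I ∪ ⁅ e ⁆)

  IsBasis : Subset n → Set
  IsBasis B = Indep B × (∀ {J} → B ⊆ J → Indep J → J ≡ B)

-- Directed cycle in D_M(B₁,B₂) traversing u₀,v₀,…,u_{l-1},v_{l-1}
-- with l = suc k ≥ 1 and indices taken modulo l.

next : ∀ {k} → Fin (suc k) → Fin (suc k)
next {k} i = suc (toℕ i) mod (suc k)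

record ExchangeCycle {n : ℕ} (M : Matroid n) (B₁ B₂ : Subset n) (k : ℕ) : Set where
  open Matroid M
  field
    u v     : Fin (suc k) → Fin n
    u-inj   : Injective _≡_ _≡_ u
    v-inj   : Injective _≡_ _≡_ v
    u∈B₁    : ∀ i → u i ∈ B₁
    u∉B₂    : ∀ i → u i ∉ B₂
    v∈B₂    : ∀ i → v i ∈ B₂
    v∉B₁    : ∀ i → v i ∉ B₁
    -- arc (u_i , v_i) : B₁ ∪ {v_i} \ {u_i} ∈ I
    arc-uv  : ∀ i → Indep (swap B₁ (v i) (u i))
    -- arc (v_i , u_{i+1}) : B₂ ∪ {u_{i+1}} \ {v_i} ∈ I
    arc-vu  : ∀ i → Indep (swap B₂ (u (next i)) (v i))

module _ {c ℓ} (K : OrderedField c ℓ) where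
  open OrderedField K

  Submodular : ∀ {n} → (Subset n → Carrier) → Set ℓ
  Submodular f = ∀ A B → f (A ∪ B) + f (A ∩ B) ≤ f A + f B

  multilinear : ∀ {n} → (Subset n → Carrier) → (Fin n → Carrier) → Carrier
  multilinear {n} f x = sumList (map term (allSubsets n))
    where
    term : Subset n → Carrier
    term S = f S * prodFin n (λ w →
      if Data.Vec.lookup S w then x w else (1# -ᶠ x w))

  𝟙 : ∀ {n} → Subset n → Fin n → Carrier
  𝟙 B w = if Data.Vec.lookup B w then 1# else 0#

  combo : ∀ {n t} → (Fin t → Carrier) → (Fin t → Subset n) → Fin n → Carrier
  combo {t = t} β B w = sumFin t (λ j → β j * 𝟙 (B j) w)

set₁ : ∀ {n s} → (Fin (suc (suc s)) → Subset n) → Subset n →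
       Fin (suc (suc s)) → Subset n
set₁ B S zero    = S
set₁ B S (suc j) = B (suc j)

set₂ : ∀ {n s} → (Fin (suc (suc s)) → Subset n) → Subset n →
       Fin (suc (suc s)) → Subset n
set₂ B S zero          = B zero
set₂ B S (suc zero)    = S
set₂ B S (suc (suc j)) = B (suc (suc j))

module _ {c ℓ} (K : OrderedField c ℓ) where
  open OrderedField K

  -- E[F(x')] for the randomized exchange along the cycle C, where
  -- B = (B₁,…,B_t) with t = suc (suc s) and C has length 2l, l = suc k.
  expectedAfterExchange :
    ∀ {n s k} (M : Matroid n) (F : (Fin n → Carrier) → Carrier)
      (β : Fin (suc (suc s)) → Carrier) (B : Fin (suc (suc s)) → Subset n)
      (C : ExchangeCycle M (B zero) (B (suc zero)) k) → Carrier
  expectedAfterExchange {k = k} M F β B C =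
      p * (sumFin (suc k) case₁ ÷ fromℕ (suc k))
    + (1# -ᶠ p) * (sumFin (suc k) case₂ ÷ fromℕ (suc k))
    where
    open ExchangeCycle C
    β₁ = β zero
    β₂ = β (suc zero)
    p  = β₂ ÷ (β₁ + β₂)
    case₁ : Fin (suc k) → Carrier
    case₁ i = F (combo K β (set₁ B (swap (B zero) (v i) (u i))))
    case₂ : Fin (suc k) → Carrier
    case₂ i = F (combo K β (set₂ B (swap (B (suc zero)) (u (next i)) (v i))))

-- F is multilinear, so on the line x + t (e_a - e_b) it is a quadratic in t whose t²-coefficient
-- F₁₀ + F₀₁ - F₁₁ - F₀₀ (F with x_a, x_b fixed to 0 or 1) is nonnegative by submodularity; hence
-- F (x + t (e_a - e_b)) ≥ F x + t (∂_a F x - ∂_b F x).  The move B₁ ↦ B₁ + v_i - u_i shifts mass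
-- β₁ from u_i to v_i, and B₂ ↦ B₂ + u_{i+1} - v_i shifts β₂ from v_i to u_{i+1}.  Averaged over i
-- the first-order terms are β₁ Δ and -β₂ Δ with Δ = Σ_i (∂_{v_i} F x - ∂_{u_i} F x), and the
-- weights β₂ / (β₁ + β₂) and β₁ / (β₁ + β₂) make them cancel.
module Submission where

open import Defs
open import Data.Nat as ℕ using (ℕ; zero; suc)
open import Data.Nat.Properties using (+-suc)
open import Data.Nat.DivMod using (m<n⇒m%n≡m; n%n≡0)
open import Data.Integer as ℤ using (ℤ; -[1+_]; _⊖_)
open import Data.Integer.Properties using ([1+m]⊖[1+n]≡m⊖n; +◃n≡+n)
import Data.Sign as Sign
open import Data.Bool using (Bool; true; false; _∨_; if_then_else_)
open import Data.Bool.Properties using (∨-idem; ∧-idem; ∨-zeroʳ; ∨-identityʳ)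
open import Data.Fin as Fin using (Fin; zero; suc; _≟_; toℕ; inject₁)
open import Data.Fin.Properties
  using (suc-injective; toℕ-injective; toℕ-fromℕ<; toℕ-fromℕ; toℕ-inject₁; toℕ<n)
open import Data.Fin.Subset using (Subset; _∪_; _∩_; _─_; ⁅_⁆; _∈_; _∉_)
open import Data.Fin.Subset.Properties using (x∈⁅x⁆; x≢y⇒x∉⁅y⁆)
open import Data.Vec using (Vec; []; _∷_; lookup; zipWith; _[_]≔_)
open import Data.Vec.Properties using (lookup-zipWith; zipWith-idem; []≔-commutes; []=⇒lookup; lookup⇒[]=)
open import Data.Vec.Functional using (Vector; updateAt; tail)
open import Data.Vec.Functional.Properties using (updateAt-updates; updateAt-minimal; updateAt-id)
open import Data.List using (List; []; _∷_; map; _++_)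
open import Data.List.Properties using (map-++; map-∘; map-cong)
open import Data.Maybe using (Maybe; just; nothing)
open import Data.Product using (_×_; _,_; proj₁; proj₂)
open import Data.Sum using (inj₁; inj₂)
open import Function using (id; _∘_)
open import Algebra.Definitions using (Idempotent)
open import Algebra.Bundles using (CommutativeRing)
open import Algebra.Solver.Ring.AlmostCommutativeRing
  using (AlmostCommutativeRing; fromCommutativeRing; _-Raw-AlmostCommutative⟶_)
open import Relation.Binary.Bundles using (Poset)
import Relation.Binary.Reasoning.PartialOrder
open import Relation.Binary.Structures using (IsTotalOrder)
open import Relation.Binary.PropositionalEquality
  using (_≡_; _≢_; _≗_; refl; sym; trans; cong; cong₂; subst; subst₂; module ≡-Reasoning)
open import Relation.Nullary using (¬_; Dec; yes; no; contradiction)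

zipWith-[]≔ : ∀ {a b c n} {A : Set a} {B : Set b} {C : Set c} (f : A → B → C)
  (xs : Vec A n) (ys : Vec B n) i x y →
  zipWith f (xs [ i ]≔ x) (ys [ i ]≔ y) ≡ zipWith f xs ys [ i ]≔ f x y
zipWith-[]≔ f (_ ∷ xs) (_ ∷ ys) zero    x y = refl
zipWith-[]≔ f (x′ ∷ xs) (y′ ∷ ys) (suc i) x y = cong (f x′ y′ ∷_) (zipWith-[]≔ f xs ys i x y)

zipWith-[]≔₂ : ∀ {n} {op : Bool → Bool → Bool} → Idempotent _≡_ op →
  ∀ (S : Subset n) a b i i′ j j′ →
  zipWith op ((S [ a ]≔ i) [ b ]≔ j) ((S [ a ]≔ i′) [ b ]≔ j′)
    ≡ (S [ a ]≔ op i i′) [ b ]≔ op j j′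
zipWith-[]≔₂ {op = op} idem S a b i i′ j j′ = begin
  zipWith op ((S [ a ]≔ i) [ b ]≔ j) ((S [ a ]≔ i′) [ b ]≔ j′)
    ≡⟨ zipWith-[]≔ op _ _ b j j′ ⟩
  zipWith op (S [ a ]≔ i) (S [ a ]≔ i′) [ b ]≔ op j j′
    ≡⟨ cong (_[ b ]≔ op j j′) (zipWith-[]≔ op S S a i i′) ⟩
  (zipWith op S S [ a ]≔ op i i′) [ b ]≔ op j j′
    ≡⟨ cong (λ T → (T [ a ]≔ op i i′) [ b ]≔ op j j′) (zipWith-idem idem S) ⟩
  (S [ a ]≔ op i i′) [ b ]≔ op j j′ ∎
  where open ≡-Reasoning

∉⇒lookup≡false : ∀ {n} {p : Subset n} {w} → w ∉ p → lookup p w ≡ false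
∉⇒lookup≡false {p = p} {w} w∉p with lookup p w in eq
... | true  = contradiction (lookup⇒[]= w p eq) w∉p
... | false = refl

x∉p∧y∈p⇒x≢y : ∀ {n} {p : Subset n} {x y} → x ∉ p → y ∈ p → x ≢ y
x∉p∧y∈p⇒x≢y x∉p y∈p refl = x∉p y∈p

lookup-─ : ∀ {n} (p q : Subset n) w → lookup (p ─ q) w ≡ (if lookup q w then false else lookup p w)
lookup-─ (_ ∷ p) (true  ∷ q) zero    = refl
lookup-─ (_ ∷ p) (false ∷ q) zero    = refl
lookup-─ (_ ∷ p) (_     ∷ q) (suc w) = lookup-─ p q w

lookup-swap-removed : ∀ {n} (B : Subset n) a b → lookup (swap B a b) b ≡ false
lookup-swap-removed B a b
  rewrite lookup-─ (B ∪ ⁅ a ⁆) ⁅ b ⁆ b | []=⇒lookup (x∈⁅x⁆ b) = refl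

lookup-swap-added : ∀ {n} (B : Subset n) {a b} → a ≢ b → lookup (swap B a b) a ≡ true
lookup-swap-added B {a} {b} a≢b
  rewrite lookup-─ (B ∪ ⁅ a ⁆) ⁅ b ⁆ a | ∉⇒lookup≡false (x≢y⇒x∉⁅y⁆ a≢b)
        | lookup-zipWith _∨_ a B ⁅ a ⁆ | []=⇒lookup (x∈⁅x⁆ a)
  = ∨-zeroʳ _

lookup-swap-other : ∀ {n} (B : Subset n) {a b w} → w ≢ a → w ≢ b → lookup (swap B a b) w ≡ lookup B w
lookup-swap-other B {a} {b} {w} w≢a w≢b
  rewrite lookup-─ (B ∪ ⁅ a ⁆) ⁅ b ⁆ w | ∉⇒lookup≡false (x≢y⇒x∉⁅y⁆ w≢b)
        | lookup-zipWith _∨_ w B ⁅ a ⁆ | ∉⇒lookup≡false (x≢y⇒x∉⁅y⁆ w≢a)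
  = ∨-identityʳ _

set₁-other : ∀ {n s} (B : Fin (suc (suc s)) → Subset n) S i → i ≢ zero → set₁ B S i ≡ B i
set₁-other B S zero    i≢0 = contradiction refl i≢0
set₁-other B S (suc i) _   = refl

set₂-other : ∀ {n s} (B : Fin (suc (suc s)) → Subset n) S i → i ≢ suc zero → set₂ B S i ≡ B i
set₂-other B S zero          _   = refl
set₂-other B S (suc zero)    i≢1 = contradiction refl i≢1
set₂-other B S (suc (suc i)) _   = refl

next-inject₁ : ∀ {k} (i : Fin k) → next (inject₁ i) ≡ suc i
next-inject₁ {k} i = toℕ-injective (begin
  toℕ (next (inject₁ i))           ≡⟨ toℕ-fromℕ< _ ⟩
  suc (toℕ (inject₁ i)) ℕ.% suc k  ≡⟨ cong (λ m → suc m ℕ.% suc k) (toℕ-inject₁ i) ⟩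
  suc (toℕ i) ℕ.% suc k            ≡⟨ m<n⇒m%n≡m (ℕ.s≤s (toℕ<n i)) ⟩
  suc (toℕ i)                      ∎)
  where open ≡-Reasoning

next-last : ∀ k → next (Fin.fromℕ k) ≡ zero
next-last k = toℕ-injective (begin
  toℕ (next (Fin.fromℕ k))           ≡⟨ toℕ-fromℕ< _ ⟩
  suc (toℕ (Fin.fromℕ k)) ℕ.% suc k  ≡⟨ cong (λ m → suc m ℕ.% suc k) (toℕ-fromℕ k) ⟩
  suc k ℕ.% suc k                    ≡⟨ n%n≡0 (suc k) ⟩
  0                                  ∎)
  where open ≡-Reasoning

module Exchange {c ℓ} (K : OrderedField c ℓ) where
  open OrderedField K

  commutativeRing : CommutativeRing c c
  commutativeRing = record { isCommutativeRing = isCommutativeRing }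

  open CommutativeRing commutativeRing
    using (+-assoc; +-comm; +-identityˡ; +-identityʳ; *-identityʳ; *-comm; distribˡ; distribʳ; zeroˡ; zeroʳ;
           -‿inverseˡ; -‿inverseʳ; ring)
  open import Algebra.Properties.Ring ring
    using (-‿distribˡ-*; -‿distribʳ-*; -‿involutive; -‿+-comm; -0#≈0#)

  -- Integer constants for the ring solver, with ℕ→K 1 = 1# definitionally so that
  -- the constant 1 of a solver polynomial denotes 1# itself.
  ℕ→K : ℕ → Carrier
  ℕ→K zero          = 0#
  ℕ→K (suc zero)    = 1#
  ℕ→K (suc (suc n)) = 1# + ℕ→K (suc n)

  ℕ→K-suc : ∀ n → ℕ→K (suc n) ≡ 1# + ℕ→K n
  ℕ→K-suc zero    = sym (+-identityʳ 1#)
  ℕ→K-suc (suc n) = refl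

  ℕ→K-+ : ∀ m n → ℕ→K (m ℕ.+ n) ≡ ℕ→K m + ℕ→K n
  ℕ→K-+ zero    n = sym (+-identityˡ _)
  ℕ→K-+ (suc m) n = begin
    ℕ→K (suc (m ℕ.+ n))       ≡⟨ ℕ→K-suc (m ℕ.+ n) ⟩
    1# + ℕ→K (m ℕ.+ n)        ≡⟨ cong (1# +_) (ℕ→K-+ m n) ⟩
    1# + (ℕ→K m + ℕ→K n)      ≡⟨ +-assoc 1# _ _ ⟨
    (1# + ℕ→K m) + ℕ→K n      ≡⟨ cong (_+ ℕ→K n) (ℕ→K-suc m) ⟨
    ℕ→K (suc m) + ℕ→K n       ∎
    where open ≡-Reasoning

  ℕ→K-* : ∀ m n → ℕ→K (m ℕ.* n) ≡ ℕ→K m * ℕ→K n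
  ℕ→K-* zero    n = sym (zeroˡ _)
  ℕ→K-* (suc m) n = begin
    ℕ→K (n ℕ.+ m ℕ.* n)          ≡⟨ ℕ→K-+ n (m ℕ.* n) ⟩
    ℕ→K n + ℕ→K (m ℕ.* n)        ≡⟨ cong₂ _+_ (sym (*-identityˡ′ _)) (ℕ→K-* m n) ⟩
    1# * ℕ→K n + ℕ→K m * ℕ→K n   ≡⟨ distribʳ _ _ _ ⟨
    (1# + ℕ→K m) * ℕ→K n         ≡⟨ cong (_* ℕ→K n) (ℕ→K-suc m) ⟨
    ℕ→K (suc m) * ℕ→K n          ∎
    where
    open ≡-Reasoning
    *-identityˡ′ : ∀ x → 1# * x ≡ x
    *-identityˡ′ x = trans (*-comm 1# x) (*-identityʳ x)

  ℤ→K : ℤ → Carrier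
  ℤ→K (ℤ.+ n)  = ℕ→K n
  ℤ→K -[1+ n ] = - ℕ→K (suc n)

  ℤ→K-⊖ : ∀ m n → ℤ→K (m ⊖ n) ≡ ℕ→K m -ᶠ ℕ→K n
  ℤ→K-⊖ m       zero    = sym (trans (cong (ℕ→K m +_) -0#≈0#) (+-identityʳ _))
  ℤ→K-⊖ zero    (suc n) = sym (+-identityˡ _)
  ℤ→K-⊖ (suc m) (suc n) = begin
    ℤ→K (suc m ⊖ suc n)                   ≡⟨ cong ℤ→K ([1+m]⊖[1+n]≡m⊖n m n) ⟩
    ℤ→K (m ⊖ n)                           ≡⟨ ℤ→K-⊖ m n ⟩
    ℕ→K m -ᶠ ℕ→K n                        ≡⟨ cancel (ℕ→K m) (ℕ→K n) ⟨
    (1# + ℕ→K m) -ᶠ (1# + ℕ→K n)          ≡⟨ cong₂ _-ᶠ_ (ℕ→K-suc m) (ℕ→K-suc n) ⟨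
    ℕ→K (suc m) -ᶠ ℕ→K (suc n)            ∎
    where
    open ≡-Reasoning
    cancel : ∀ x y → (1# + x) -ᶠ (1# + y) ≡ x -ᶠ y
    cancel x y = begin
      (1# + x) + - (1# + y)     ≡⟨ cong ((1# + x) +_) (-‿+-comm 1# y) ⟨
      (1# + x) + (- 1# + - y)   ≡⟨ cong (_+ (- 1# + - y)) (+-comm 1# x) ⟩
      (x + 1#) + (- 1# + - y)   ≡⟨ +-assoc x 1# _ ⟩
      x + (1# + (- 1# + - y))   ≡⟨ cong (x +_) (+-assoc 1# (- 1#) (- y)) ⟨
      x + ((1# + - 1#) + - y)   ≡⟨ cong (λ z → x + (z + - y)) (-‿inverseʳ 1#) ⟩
      x + (0# + - y)            ≡⟨ cong (x +_) (+-identityˡ (- y)) ⟩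
      x + - y                   ∎

  ℤ→K-+ : ∀ i j → ℤ→K (i ℤ.+ j) ≡ ℤ→K i + ℤ→K j
  ℤ→K-+ (ℤ.+ m)  (ℤ.+ n)  = ℕ→K-+ m n
  ℤ→K-+ (ℤ.+ m)  -[1+ n ] = ℤ→K-⊖ m (suc n)
  ℤ→K-+ -[1+ m ] (ℤ.+ n)  = trans (ℤ→K-⊖ n (suc m)) (+-comm _ _)
  ℤ→K-+ -[1+ m ] -[1+ n ] = begin
    - ℕ→K (suc (suc (m ℕ.+ n)))       ≡⟨ cong (λ k → - ℕ→K (suc k)) (+-suc m n) ⟨
    - ℕ→K (suc m ℕ.+ suc n)           ≡⟨ cong -_ (ℕ→K-+ (suc m) (suc n)) ⟩
    - (ℕ→K (suc m) + ℕ→K (suc n))     ≡⟨ -‿+-comm _ _ ⟨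
    - ℕ→K (suc m) + - ℕ→K (suc n)     ∎
    where open ≡-Reasoning


  ℤ→K-−◃ : ∀ n → ℤ→K (Sign.- ℤ.◃ n) ≡ - ℕ→K n
  ℤ→K-−◃ zero    = sym -0#≈0#
  ℤ→K-−◃ (suc n) = refl

  ℤ→K-* : ∀ i j → ℤ→K (i ℤ.* j) ≡ ℤ→K i * ℤ→K j
  ℤ→K-* (ℤ.+ m)  (ℤ.+ n)  = trans (cong ℤ→K (+◃n≡+n (m ℕ.* n))) (ℕ→K-* m n)
  ℤ→K-* (ℤ.+ m)  -[1+ n ] = begin
    ℤ→K (Sign.- ℤ.◃ (m ℕ.* suc n))   ≡⟨ ℤ→K-−◃ (m ℕ.* suc n) ⟩
    - ℕ→K (m ℕ.* suc n)              ≡⟨ cong -_ (ℕ→K-* m (suc n)) ⟩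
    - (ℕ→K m * ℕ→K (suc n))          ≡⟨ -‿distribʳ-* _ _ ⟩
    ℕ→K m * - ℕ→K (suc n)            ∎
    where open ≡-Reasoning
  ℤ→K-* -[1+ m ] (ℤ.+ n)  = begin
    ℤ→K (Sign.- ℤ.◃ (suc m ℕ.* n))   ≡⟨ ℤ→K-−◃ (suc m ℕ.* n) ⟩
    - ℕ→K (suc m ℕ.* n)              ≡⟨ cong -_ (ℕ→K-* (suc m) n) ⟩
    - (ℕ→K (suc m) * ℕ→K n)          ≡⟨ -‿distribˡ-* _ _ ⟩
    - ℕ→K (suc m) * ℕ→K n            ∎
    where open ≡-Reasoning
  ℤ→K-* -[1+ m ] -[1+ n ] = begin
    ℕ→K (suc m ℕ.* suc n)                ≡⟨ ℕ→K-* (suc m) (suc n) ⟩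
    ℕ→K (suc m) * ℕ→K (suc n)            ≡⟨ -‿involutive _ ⟨
    - - (ℕ→K (suc m) * ℕ→K (suc n))      ≡⟨ cong -_ (-‿distribˡ-* _ _) ⟩
    - (- ℕ→K (suc m) * ℕ→K (suc n))      ≡⟨ -‿distribʳ-* _ _ ⟩
    - ℕ→K (suc m) * - ℕ→K (suc n)        ∎
    where open ≡-Reasoning

  ℤ→K-neg : ∀ i → ℤ→K (ℤ.- i) ≡ - ℤ→K i
  ℤ→K-neg (ℤ.+ zero)    = sym -0#≈0#
  ℤ→K-neg (ℤ.+ (suc n)) = refl
  ℤ→K-neg -[1+ n ]      = sym (-‿involutive _)

  almostCommutativeRing : AlmostCommutativeRing c c
  almostCommutativeRing = fromCommutativeRing commutativeRing

  ℤ→K-morphism : ℤ.+-*-rawRing -Raw-AlmostCommutative⟶ almostCommutativeRing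
  ℤ→K-morphism = record
    { ⟦_⟧    = ℤ→K
    ; +-homo = ℤ→K-+
    ; *-homo = ℤ→K-*
    ; -‿homo = ℤ→K-neg
    ; 0-homo = refl
    ; 1-homo = refl
    }

  ℤ→K-≟ : ∀ i j → Maybe (ℤ→K i ≡ ℤ→K j)
  ℤ→K-≟ i j with i ℤ.≟ j
  ... | yes i≡j = just (cong ℤ→K i≡j)
  ... | no _    = nothing

  open import Algebra.Solver.Ring ℤ.+-*-rawRing almostCommutativeRing ℤ→K-morphism ℤ→K-≟

  :0 :1 : ∀ {m} → Polynomial m
  :0 = con (ℤ.+ 0)
  :1 = con (ℤ.+ 1)

  -- Ordered fields

  poset : Poset c c ℓ
  poset = record { isPartialOrder = IsTotalOrder.isPartialOrder isTotalOrder }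

  open Poset poset using (antisym) renaming (refl to ≤-refl; trans to ≤-trans)
  open IsTotalOrder isTotalOrder using (total)
  module ≤-Reasoning = Relation.Binary.Reasoning.PartialOrder poset

  +-monoʳ-≤ : ∀ z {x y} → x ≤ y → z + x ≤ z + y
  +-monoʳ-≤ z {x} {y} x≤y = subst₂ _≤_ (+-comm x z) (+-comm y z) (+-mono-≤ z x≤y)

  +-mono₂-≤ : ∀ {x y u v} → x ≤ y → u ≤ v → x + u ≤ y + v
  +-mono₂-≤ {y = y} {u} x≤y u≤v = ≤-trans (+-mono-≤ u x≤y) (+-monoʳ-≤ y u≤v)

  x≤y⇒0≤y-x : ∀ {x y} → x ≤ y → 0# ≤ y -ᶠ x
  x≤y⇒0≤y-x {x} x≤y = subst (_≤ _) (-‿inverseʳ x) (+-mono-≤ (- x) x≤y)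

  x≤0⇒0≤-x : ∀ {x} → x ≤ 0# → 0# ≤ - x
  x≤0⇒0≤-x {x} x≤0 = subst₂ _≤_ (-‿inverseʳ x) (+-identityˡ (- x)) (+-mono-≤ (- x) x≤0)

  *-monoʳ-≤ : ∀ {z x y} → 0# ≤ z → x ≤ y → z * x ≤ z * y
  *-monoʳ-≤ {z} {x} {y} 0≤z x≤y = subst₂ _≤_ (+-identityˡ (z * x)) z[y-x]+zx≡zy
    (+-mono-≤ (z * x) (*-nonneg 0≤z (x≤y⇒0≤y-x x≤y)))
    where
    z[y-x]+zx≡zy : z * (y -ᶠ x) + z * x ≡ z * y
    z[y-x]+zx≡zy = solve 3 (λ z x y → z :* (y :- x) :+ z :* x := z :* y) refl z x y

  *-monoˡ-≤ : ∀ {z x y} → 0# ≤ z → x ≤ y → x * z ≤ y * z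
  *-monoˡ-≤ {z} {x} {y} 0≤z x≤y = subst₂ _≤_ (*-comm z x) (*-comm z y) (*-monoʳ-≤ 0≤z x≤y)

  0≤x*x : ∀ x → 0# ≤ x * x
  0≤x*x x with total 0# x
  ... | inj₁ 0≤x = *-nonneg 0≤x 0≤x
  ... | inj₂ x≤0 = subst (0# ≤_) (solve 1 (λ x → (:- x) :* (:- x) := x :* x) refl x)
                     (*-nonneg (x≤0⇒0≤-x x≤0) (x≤0⇒0≤-x x≤0))

  0≤1 : 0# ≤ 1#
  0≤1 = subst (0# ≤_) (*-identityʳ 1#) (0≤x*x 1#)

  +-nonneg : ∀ {x y} → 0# ≤ x → 0# ≤ y → 0# ≤ x + y
  +-nonneg 0≤x 0≤y = subst (_≤ _) (+-identityʳ 0#) (+-mono₂-≤ 0≤x 0≤y)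

  ⁻¹-nonneg : ∀ {x} → 0# ≤ x → x ≢ 0# → 0# ≤ x ⁻¹
  ⁻¹-nonneg {x} 0≤x x≢0 with total 0# (x ⁻¹)
  ... | inj₁ 0≤x⁻¹ = 0≤x⁻¹
  ... | inj₂ x⁻¹≤0 = contradiction (antisym 0≤1 1≤0) 0≢1
    where
    0≤-1 : 0# ≤ - 1#
    0≤-1 = subst (0# ≤_) (trans (sym (-‿distribʳ-* x (x ⁻¹))) (cong -_ (⁻¹-inverse x x≢0)))
             (*-nonneg 0≤x (x≤0⇒0≤-x x⁻¹≤0))
    1≤0 : 1# ≤ 0#
    1≤0 = subst₂ _≤_ (+-identityˡ 1#) (-‿inverseˡ 1#) (+-mono-≤ 1# 0≤-1)

  fromℕ-nonneg : ∀ m → 0# ≤ fromℕ m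
  fromℕ-nonneg zero    = ≤-refl
  fromℕ-nonneg (suc m) = +-nonneg 0≤1 (fromℕ-nonneg m)

  fromℕ-suc≢0 : ∀ m → fromℕ (suc m) ≢ 0#
  fromℕ-suc≢0 m 1+m≡0 = 0≢1 (antisym 0≤1 1≤0)
    where
    1≤0 : 1# ≤ 0#
    1≤0 = subst₂ _≤_ (+-identityʳ 1#) 1+m≡0 (+-monoʳ-≤ 1# (fromℕ-nonneg m))

  -- Finite sums

  sumFin-cong : ∀ m {g h : Fin m → Carrier} → (∀ i → g i ≡ h i) → sumFin m g ≡ sumFin m h
  sumFin-cong zero    g≗h = refl
  sumFin-cong (suc m) g≗h = cong₂ _+_ (g≗h zero) (sumFin-cong m (g≗h ∘ suc))

  sumFin-nonneg : ∀ m {g : Fin m → Carrier} → (∀ i → 0# ≤ g i) → 0# ≤ sumFin m g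
  sumFin-nonneg zero    0≤g = ≤-refl
  sumFin-nonneg (suc m) 0≤g = +-nonneg (0≤g zero) (sumFin-nonneg m (0≤g ∘ suc))

  sumFin-mono : ∀ m {g h : Fin m → Carrier} → (∀ i → g i ≤ h i) → sumFin m g ≤ sumFin m h
  sumFin-mono zero    g≤h = ≤-refl
  sumFin-mono (suc m) g≤h = +-mono₂-≤ (g≤h zero) (sumFin-mono m (g≤h ∘ suc))

  sumFin-affine : ∀ m a t (δ : Fin m → Carrier) →
    sumFin m (λ i → a + t * δ i) ≡ fromℕ m * a + t * sumFin m δ
  sumFin-affine zero    a t δ = solve 2 (λ a t → :0 := :0 :* a :+ t :* :0) refl a t
  sumFin-affine (suc m) a t δ = begin
    (a + t * δ zero) + sumFin m (λ i → a + t * δ (suc i))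
      ≡⟨ cong ((a + t * δ zero) +_) (sumFin-affine m a t (δ ∘ suc)) ⟩
    (a + t * δ zero) + (fromℕ m * a + t * sumFin m (δ ∘ suc))
      ≡⟨ solve 5 (λ a t d M Σ → (a :+ t :* d) :+ (M :* a :+ t :* Σ) := (:1 :+ M) :* a :+ t :* (d :+ Σ))
               refl a t (δ zero) (fromℕ m) (sumFin m (δ ∘ suc)) ⟩
    fromℕ (suc m) * a + t * sumFin (suc m) δ ∎
    where open ≡-Reasoning

  sumFin-diff : ∀ m (g h : Fin m → Carrier) → sumFin m (λ i → g i -ᶠ h i) ≡ sumFin m g -ᶠ sumFin m h
  sumFin-diff zero    g h = solve 0 (:0 := :0 :- :0) refl
  sumFin-diff (suc m) g h = begin
    (g zero -ᶠ h zero) + sumFin m (λ i → g (suc i) -ᶠ h (suc i))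
      ≡⟨ cong ((g zero -ᶠ h zero) +_) (sumFin-diff m (g ∘ suc) (h ∘ suc)) ⟩
    (g zero -ᶠ h zero) + (sumFin m (g ∘ suc) -ᶠ sumFin m (h ∘ suc))
      ≡⟨ solve 4 (λ a b A B → (a :- b) :+ (A :- B) := (a :+ A) :- (b :+ B)) refl _ _ _ _ ⟩
    sumFin (suc m) g -ᶠ sumFin (suc m) h ∎
    where open ≡-Reasoning

  sumFin-change : ∀ m (g h : Fin m → Carrier) j → (∀ i → i ≢ j → h i ≡ g i) →
    sumFin m h ≡ sumFin m g + (h j -ᶠ g j)
  sumFin-change (suc m) g h zero    h≡g = begin
    h zero + sumFin m (h ∘ suc)
      ≡⟨ cong (h zero +_) (sumFin-cong m (λ i → h≡g (suc i) λ ())) ⟩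
    h zero + sumFin m (g ∘ suc)
      ≡⟨ solve 3 (λ g h Σ → h :+ Σ := (g :+ Σ) :+ (h :- g)) refl _ _ _ ⟩
    sumFin (suc m) g + (h zero -ᶠ g zero) ∎
    where open ≡-Reasoning
  sumFin-change (suc m) g h (suc j) h≡g = begin
    h zero + sumFin m (h ∘ suc)
      ≡⟨ cong₂ _+_ (h≡g zero λ ())
           (sumFin-change m (g ∘ suc) (h ∘ suc) j (λ i i≢j → h≡g (suc i) (i≢j ∘ suc-injective))) ⟩
    g zero + (sumFin m (g ∘ suc) + (h (suc j) -ᶠ g (suc j)))
      ≡⟨ +-assoc _ _ _ ⟨
    sumFin (suc m) g + (h (suc j) -ᶠ g (suc j)) ∎
    where open ≡-Reasoning

  sumFin-last : ∀ m (g : Fin (suc m) → Carrier) →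
    sumFin (suc m) g ≡ sumFin m (g ∘ inject₁) + g (Fin.fromℕ m)
  sumFin-last zero    g = trans (+-identityʳ _) (sym (+-identityˡ _))
  sumFin-last (suc m) g = trans (cong (g zero +_) (sumFin-last m (g ∘ suc))) (sym (+-assoc _ _ _))

  sumFin-rotate : ∀ k (g : Fin (suc k) → Carrier) → sumFin (suc k) (g ∘ next) ≡ sumFin (suc k) g
  sumFin-rotate k g = begin
    sumFin (suc k) (g ∘ next)
      ≡⟨ sumFin-last k (g ∘ next) ⟩
    sumFin k (g ∘ next ∘ inject₁) + g (next (Fin.fromℕ k))
      ≡⟨ cong₂ _+_ (sumFin-cong k (cong g ∘ next-inject₁)) (cong g (next-last k)) ⟩
    sumFin k (g ∘ suc) + g zero
      ≡⟨ +-comm _ _ ⟩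
    sumFin (suc k) g ∎
    where open ≡-Reasoning

  sumFin-cycle : ∀ k (g h : Fin (suc k) → Carrier) →
    sumFin (suc k) (λ i → h (next i) -ᶠ g i) ≡ - sumFin (suc k) (λ i → g i -ᶠ h i)
  sumFin-cycle k g h = begin
    sumFin (suc k) (λ i → h (next i) -ᶠ g i)
      ≡⟨ sumFin-diff (suc k) (h ∘ next) g ⟩
    sumFin (suc k) (h ∘ next) -ᶠ sumFin (suc k) g
      ≡⟨ cong (_-ᶠ sumFin (suc k) g) (sumFin-rotate k h) ⟩
    sumFin (suc k) h -ᶠ sumFin (suc k) g
      ≡⟨ solve 2 (λ G H → H :- G := :- (G :- H)) refl _ _ ⟩
    - (sumFin (suc k) g -ᶠ sumFin (suc k) h)
      ≡⟨ cong -_ (sumFin-diff (suc k) g h) ⟨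
    - sumFin (suc k) (λ i → g i -ᶠ h i) ∎
    where open ≡-Reasoning

  -- The multilinear extension

  lerp : Carrier → Carrier → Carrier → Carrier
  lerp γ p q = (1# -ᶠ γ) * p + γ * q

  lerp-same : ∀ γ p → lerp γ p p ≡ p
  lerp-same = solve 2 (λ γ p → (:1 :- γ) :* p :+ γ :* p := p) refl

  lerp-+ : ∀ γ p q p′ q′ → lerp γ (p + p′) (q + q′) ≡ lerp γ p q + lerp γ p′ q′
  lerp-+ = solve 5 (λ γ p q p′ q′ → (:1 :- γ) :* (p :+ p′) :+ γ :* (q :+ q′)
                                   := ((:1 :- γ) :* p :+ γ :* q) :+ ((:1 :- γ) :* p′ :+ γ :* q′)) refl

  lerp-interchange : ∀ γ δ p q r s → lerp γ (lerp δ p q) (lerp δ r s) ≡ lerp δ (lerp γ p r) (lerp γ q s)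
  lerp-interchange = solve 6 (λ γ δ p q r s →
      (:1 :- γ) :* ((:1 :- δ) :* p :+ δ :* q) :+ γ :* ((:1 :- δ) :* r :+ δ :* s)
    := (:1 :- δ) :* ((:1 :- γ) :* p :+ γ :* r) :+ δ :* ((:1 :- γ) :* q :+ γ :* s)) refl

  lerp-mono : ∀ {γ p q p′ q′} → 0# ≤ γ → γ ≤ 1# → p ≤ p′ → q ≤ q′ →
    lerp γ p q ≤ lerp γ p′ q′
  lerp-mono 0≤γ γ≤1 p≤p′ q≤q′ =
    +-mono₂-≤ (*-monoʳ-≤ (x≤y⇒0≤y-x γ≤1) p≤p′) (*-monoʳ-≤ 0≤γ q≤q′)

  InUnitCube : ∀ {n} → Vector Carrier n → Set ℓ
  InUnitCube x = ∀ w → 0# ≤ x w × x w ≤ 1#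

  ml : ∀ {n} → (Subset n → Carrier) → Vector Carrier n → Carrier
  ml {zero}  g x = g []
  ml {suc n} g x = lerp (x zero) (ml (g ∘ (false ∷_)) (tail x)) (ml (g ∘ (true ∷_)) (tail x))

  -- Definitionally the summand of multilinear, which Defs keeps local to a where block.
  monomial : ∀ {n} → (Subset n → Carrier) → Vector Carrier n → Subset n → Carrier
  monomial {n} f x S = f S * prodFin n (λ w → if lookup S w then x w else (1# -ᶠ x w))

  sumList-++ : ∀ xs ys → sumList (xs ++ ys) ≡ sumList xs + sumList ys
  sumList-++ []       ys = sym (+-identityˡ _)
  sumList-++ (x ∷ xs) ys = trans (cong (x +_) (sumList-++ xs ys)) (sym (+-assoc _ _ _))

  sumList-scale : ∀ {a} {A : Set a} c (h : A → Carrier) (L : List A) →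
    sumList (map (λ S → c * h S) L) ≡ c * sumList (map h L)
  sumList-scale c h []      = sym (zeroʳ c)
  sumList-scale c h (S ∷ L) = trans (cong (c * h S +_) (sumList-scale c h L)) (sym (distribˡ c _ _))

  multilinear≡ml : ∀ {n} (f : Subset n → Carrier) x → multilinear K f x ≡ ml f x
  multilinear≡ml {zero}  f x = trans (+-identityʳ _) (*-identityʳ _)
  multilinear≡ml {suc n} f x = begin
    sumList (map (monomial f x) (map (false ∷_) L ++ map (true ∷_) L))
      ≡⟨ cong sumList (map-++ (monomial f x) (map (false ∷_) L) _) ⟩
    sumList (map (monomial f x) (map (false ∷_) L) ++ map (monomial f x) (map (true ∷_) L))
      ≡⟨ sumList-++ (map (monomial f x) (map (false ∷_) L)) _ ⟩
    sumList (map (monomial f x) (map (false ∷_) L)) + sumList (map (monomial f x) (map (true ∷_) L))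
      ≡⟨ cong₂ _+_ (cofactor false) (cofactor true) ⟩
    ml f x ∎
    where
    open ≡-Reasoning
    L : List (Subset n)
    L = allSubsets n
    weight : Bool → Carrier
    weight b = if b then x zero else (1# -ᶠ x zero)
    cofactor : ∀ b → sumList (map (monomial f x) (map (b ∷_) L)) ≡ weight b * ml (f ∘ (b ∷_)) (tail x)
    cofactor b = begin
      sumList (map (monomial f x) (map (b ∷_) L))
        ≡⟨ cong sumList (map-∘ {g = monomial f x} L) ⟨
      sumList (map (monomial f x ∘ (b ∷_)) L)
        ≡⟨ cong sumList (map-cong (λ S →
             solve 3 (λ a w p → a :* (w :* p) := w :* (a :* p)) refl (f (b ∷ S)) (weight b) _) L) ⟩
      sumList (map (λ S → weight b * monomial (f ∘ (b ∷_)) (tail x) S) L)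
        ≡⟨ sumList-scale (weight b) _ L ⟩
      weight b * sumList (map (monomial (f ∘ (b ∷_)) (tail x)) L)
        ≡⟨ cong (weight b *_) (multilinear≡ml (f ∘ (b ∷_)) (tail x)) ⟩
      weight b * ml (f ∘ (b ∷_)) (tail x) ∎

  ml-cong : ∀ {n} (g : Subset n → Carrier) {x y} → x ≗ y → ml g x ≡ ml g y
  ml-cong {zero}  g x≗y = refl
  ml-cong {suc n} g {x} {y} x≗y = trans
    (cong (λ γ → lerp γ (ml (g ∘ (false ∷_)) (tail x)) (ml (g ∘ (true ∷_)) (tail x))) (x≗y zero))
    (cong₂ (lerp (y zero)) (ml-cong (g ∘ (false ∷_)) (x≗y ∘ suc))
                           (ml-cong (g ∘ (true ∷_)) (x≗y ∘ suc)))

  ml-congˡ : ∀ {n} {g h : Subset n → Carrier} → g ≗ h → ∀ x → ml g x ≡ ml h x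
  ml-congˡ {zero}  g≗h x = g≗h []
  ml-congˡ {suc n} g≗h x =
    cong₂ (lerp (x zero)) (ml-congˡ (g≗h ∘ (false ∷_)) (tail x)) (ml-congˡ (g≗h ∘ (true ∷_)) (tail x))

  ml-+ : ∀ {n} (g h : Subset n → Carrier) x → ml (λ S → g S + h S) x ≡ ml g x + ml h x
  ml-+ {zero}  g h x = refl
  ml-+ {suc n} g h x = trans
    (cong₂ (lerp (x zero)) (ml-+ (g ∘ (false ∷_)) (h ∘ (false ∷_)) (tail x))
                           (ml-+ (g ∘ (true ∷_)) (h ∘ (true ∷_)) (tail x)))
    (lerp-+ (x zero) _ _ _ _)

  ml-mono : ∀ {n} {g h : Subset n → Carrier} {x} → InUnitCube x → (∀ S → g S ≤ h S) →
    ml g x ≤ ml h x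
  ml-mono {zero}  cube g≤h = g≤h []
  ml-mono {suc n} cube g≤h = lerp-mono (proj₁ (cube zero)) (proj₂ (cube zero))
    (ml-mono (cube ∘ suc) (g≤h ∘ (false ∷_))) (ml-mono (cube ∘ suc) (g≤h ∘ (true ∷_)))

  infix 5 _∣_≔_
  _∣_≔_ : ∀ {n} → (Subset n → Carrier) → Fin n → Bool → Subset n → Carrier
  (g ∣ b ≔ j) S = g (S [ b ]≔ j)

  ml-updateAt : ∀ {n} (g : Subset n → Carrier) x b (φ : Carrier → Carrier) →
    ml g (updateAt x b φ) ≡ lerp (φ (x b)) (ml (g ∣ b ≔ false) x) (ml (g ∣ b ≔ true) x)
  ml-updateAt g x zero    φ = sym (cong₂ (lerp (φ (x zero))) (lerp-same _ _) (lerp-same _ _))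
  ml-updateAt g x (suc b) φ = trans
    (cong₂ (lerp (x zero)) (ml-updateAt (g ∘ (false ∷_)) (tail x) b φ)
                           (ml-updateAt (g ∘ (true ∷_)) (tail x) b φ))
    (lerp-interchange (x zero) (φ (x (suc b))) _ _ _ _)

  ml-expandAt : ∀ {n} (g : Subset n → Carrier) x b →
    ml g x ≡ lerp (x b) (ml (g ∣ b ≔ false) x) (ml (g ∣ b ≔ true) x)
  ml-expandAt g x b = trans (ml-cong g (sym ∘ updateAt-id b x)) (ml-updateAt g x b id)

  bilinear : (Bool → Bool → Carrier) → Carrier → Carrier → Carrier
  bilinear G α β = lerp β (lerp α (G false false) (G true false)) (lerp α (G false true) (G true true))

  bilinear-transfer-≥ : ∀ G α β t → G true true + G false false ≤ G true false + G false true →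
    bilinear G α β
      + t * ((lerp β (G true false) (G true true) -ᶠ lerp β (G false false) (G false true))
            -ᶠ (lerp α (G false true) (G true true) -ᶠ lerp α (G false false) (G true false)))
    ≤ bilinear G (α + t) (β -ᶠ t)
  bilinear-transfer-≥ G α β t corner = subst₂ _≤_ (+-identityʳ _)
    (solve 7 (λ α β t ff tf ft tt →
        ((:1 :- β) :* ((:1 :- α) :* ff :+ α :* tf) :+ β :* ((:1 :- α) :* ft :+ α :* tt))
        :+ t :* ((((:1 :- β) :* tf :+ β :* tt) :- ((:1 :- β) :* ff :+ β :* ft))
              :- (((:1 :- α) :* ft :+ α :* tt) :- ((:1 :- α) :* ff :+ α :* tf)))
        :+ t :* t :* ((tf :+ ft) :- (tt :+ ff))
      := (:1 :- (β :- t)) :* ((:1 :- (α :+ t)) :* ff :+ (α :+ t) :* tf)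
         :+ (β :- t) :* ((:1 :- (α :+ t)) :* ft :+ (α :+ t) :* tt))
      refl α β t (G false false) (G true false) (G false true) (G true true))
    (+-monoʳ-≤ _ (*-nonneg (0≤x*x t) (x≤y⇒0≤y-x corner)))

  transfer : ∀ {n} → Vector Carrier n → Fin n → Fin n → Carrier → Vector Carrier n
  transfer x a b t = updateAt (updateAt x a (_+ t)) b (_-ᶠ t)

  cofactor₂ : ∀ {n} → (Subset n → Carrier) → Vector Carrier n → Fin n → Fin n →
    Bool → Bool → Carrier
  cofactor₂ g x a b i j = ml ((g ∣ b ≔ j) ∣ a ≔ i) x

  ∂ : ∀ {n} → (Subset n → Carrier) → Fin n → Vector Carrier n → Carrier
  ∂ g a x = ml (g ∣ a ≔ true) x -ᶠ ml (g ∣ a ≔ false) x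

  module _ {n} (g : Subset n → Carrier) (x : Vector Carrier n) {a b : Fin n} (a≢b : a ≢ b) where
    private
      G : Bool → Bool → Carrier
      G = cofactor₂ g x a b

    ml-updateAt₂ : ∀ φ ψ → ml g (updateAt (updateAt x a φ) b ψ) ≡ bilinear G (φ (x a)) (ψ (x b))
    ml-updateAt₂ φ ψ = begin
      ml g (updateAt y b ψ)
        ≡⟨ ml-updateAt g y b ψ ⟩
      lerp (ψ (y b)) (ml (g ∣ b ≔ false) y) (ml (g ∣ b ≔ true) y)
        ≡⟨ cong (λ yb → lerp (ψ yb) (ml (g ∣ b ≔ false) y) (ml (g ∣ b ≔ true) y))
                (updateAt-minimal b a x (a≢b ∘ sym)) ⟩
      lerp (ψ (x b)) (ml (g ∣ b ≔ false) y) (ml (g ∣ b ≔ true) y)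
        ≡⟨ cong₂ (lerp (ψ (x b))) (ml-updateAt (g ∣ b ≔ false) x a φ)
                                  (ml-updateAt (g ∣ b ≔ true) x a φ) ⟩
      bilinear G (φ (x a)) (ψ (x b)) ∎
      where
      open ≡-Reasoning
      y : Vector Carrier n
      y = updateAt x a φ

    ml≡bilinear : ml g x ≡ bilinear G (x a) (x b)
    ml≡bilinear = trans (ml-cong g (λ w → sym (trans (updateAt-id b _ w) (updateAt-id a x w))))
                        (ml-updateAt₂ id id)

    ∂-first : ∂ g a x ≡ lerp (x b) (G true false) (G true true) -ᶠ lerp (x b) (G false false) (G false true)
    ∂-first = cong₂ _-ᶠ_ (expand true) (expand false)
      where
      commute : ∀ i j → ml ((g ∣ a ≔ i) ∣ b ≔ j) x ≡ G i j
      commute i j = ml-congˡ (λ S → cong g ([]≔-commutes S b a (a≢b ∘ sym))) x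
      expand : ∀ i → ml (g ∣ a ≔ i) x ≡ lerp (x b) (G i false) (G i true)
      expand i = trans (ml-expandAt (g ∣ a ≔ i) x b) (cong₂ (lerp (x b)) (commute i false) (commute i true))

    ∂-second : ∂ g b x ≡ lerp (x a) (G false true) (G true true) -ᶠ lerp (x a) (G false false) (G true false)
    ∂-second = cong₂ _-ᶠ_ (ml-expandAt (g ∣ b ≔ true) x a) (ml-expandAt (g ∣ b ≔ false) x a)

    cofactor₂-submodular : Submodular K g → InUnitCube x →
      G true true + G false false ≤ G true false + G false true
    cofactor₂-submodular submodular cube = begin
      G true true + G false false
        ≡⟨ ml-+ (λ S → g (corner S true true)) (λ S → g (corner S false false)) x ⟨
      ml (λ S → g (corner S true true) + g (corner S false false)) x
        ≡⟨ ml-congˡ (λ S → cong₂ _+_ (cong g (zipWith-[]≔₂ ∨-idem S a b true false false true))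
                                     (cong g (zipWith-[]≔₂ ∧-idem S a b true false false true))) x ⟨
      ml (λ S → g (corner S true false ∪ corner S false true)
              + g (corner S true false ∩ corner S false true)) x
        ≤⟨ ml-mono cube (λ S → submodular (corner S true false) (corner S false true)) ⟩
      ml (λ S → g (corner S true false) + g (corner S false true)) x
        ≡⟨ ml-+ (λ S → g (corner S true false)) (λ S → g (corner S false true)) x ⟩
      G true false + G false true ∎
      where
      open ≤-Reasoning
      corner : Subset n → Bool → Bool → Subset n
      corner S i j = (S [ a ]≔ i) [ b ]≔ j

    ml-transfer-≥ : Submodular K g → InUnitCube x → ∀ t →
      ml g x + t * (∂ g a x -ᶠ ∂ g b x) ≤ ml g (transfer x a b t)
    ml-transfer-≥ submodular cube t = subst₂ _≤_
      (sym (cong₂ (λ F D → F + t * D) ml≡bilinear (cong₂ _-ᶠ_ ∂-first ∂-second)))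
      (sym (ml-updateAt₂ (_+ t) (_-ᶠ t)))
      (bilinear-transfer-≥ G (x a) (x b) t (cofactor₂-submodular submodular cube))

  -- Exchanges of basis elements

  transfer-gain : ∀ {n} (x : Vector Carrier n) {a b} t → a ≢ b → transfer x a b t a ≡ x a + t
  transfer-gain x {a} {b} t a≢b = trans (updateAt-minimal a b _ a≢b) (updateAt-updates a x)

  transfer-loss : ∀ {n} (x : Vector Carrier n) {a b} t → a ≢ b → transfer x a b t b ≡ x b -ᶠ t
  transfer-loss x {a} {b} t a≢b =
    trans (updateAt-updates b _) (cong (_-ᶠ t) (updateAt-minimal b a x (a≢b ∘ sym)))

  transfer-other : ∀ {n} (x : Vector Carrier n) {a b w} t → w ≢ a → w ≢ b → transfer x a b t w ≡ x w
  transfer-other x {a} {b} {w} t w≢a w≢b = trans (updateAt-minimal w b _ w≢b) (updateAt-minimal w a x w≢a)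

  𝟙-lookup : ∀ {n} (B : Subset n) w {s} → lookup B w ≡ s → 𝟙 K B w ≡ (if s then 1# else 0#)
  𝟙-lookup B w = cong (λ s → if s then 1# else 0#)

  combo-exchange : ∀ {n m} (β : Fin m → Carrier) (B B′ : Fin m → Subset n) j {a b} →
    a ∉ B j → b ∈ B j → B′ j ≡ swap (B j) a b → (∀ i → i ≢ j → B′ i ≡ B i) →
    combo K β B′ ≗ transfer (combo K β B) a b (β j)
  combo-exchange {n} {m} β B B′ j {a} {b} a∉Bj b∈Bj B′j≡swap B′≡B w = begin
    combo K β B′ w
      ≡⟨ sumFin-change m (λ i → β i * 𝟙 K (B i) w) (λ i → β i * 𝟙 K (B′ i) w) j
           (λ i i≢j → cong (λ S → β i * 𝟙 K S w) (B′≡B i i≢j)) ⟩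
    x w + (t * 𝟙 K (B′ j) w -ᶠ t * 𝟙 K (B j) w)
      ≡⟨ cong (λ S → x w + (t * 𝟙 K S w -ᶠ t * 𝟙 K (B j) w)) B′j≡swap ⟩
    x w + (t * 𝟙 K (swap (B j) a b) w -ᶠ t * 𝟙 K (B j) w)
      ≡⟨ shift w (w ≟ a) (w ≟ b) ⟩
    transfer x a b t w ∎
    where
    open ≡-Reasoning
    x : Vector Carrier n
    x = combo K β B
    t : Carrier
    t = β j
    a≢b : a ≢ b
    a≢b = x∉p∧y∈p⇒x≢y a∉Bj b∈Bj
    change : Carrier → Carrier → Carrier → Carrier
    change y p q = y + (t * p -ᶠ t * q)
    shift : ∀ w → Dec (w ≡ a) → Dec (w ≡ b) →
      change (x w) (𝟙 K (swap (B j) a b) w) (𝟙 K (B j) w) ≡ transfer x a b t w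
    shift w (yes refl) _ = begin
      change (x a) (𝟙 K (swap (B j) a b) a) (𝟙 K (B j) a)
        ≡⟨ cong₂ (change (x a)) (𝟙-lookup (swap (B j) a b) a (lookup-swap-added (B j) a≢b))
                                (𝟙-lookup (B j) a (∉⇒lookup≡false a∉Bj)) ⟩
      change (x a) 1# 0#
        ≡⟨ solve 2 (λ y t → y :+ (t :* :1 :- t :* :0) := y :+ t) refl (x a) t ⟩
      x a + t
        ≡⟨ transfer-gain x t a≢b ⟨
      transfer x a b t a ∎
    shift w (no _) (yes refl) = begin
      change (x b) (𝟙 K (swap (B j) a b) b) (𝟙 K (B j) b)
        ≡⟨ cong₂ (change (x b)) (𝟙-lookup (swap (B j) a b) b (lookup-swap-removed (B j) a b))
                                (𝟙-lookup (B j) b ([]=⇒lookup b∈Bj)) ⟩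
      change (x b) 0# 1#
        ≡⟨ solve 2 (λ y t → y :+ (t :* :0 :- t :* :1) := y :- t) refl (x b) t ⟩
      x b -ᶠ t
        ≡⟨ transfer-loss x t a≢b ⟨
      transfer x a b t b ∎
    shift w (no w≢a) (no w≢b) = begin
      change (x w) (𝟙 K (swap (B j) a b) w) (𝟙 K (B j) w)
        ≡⟨ cong (λ p → change (x w) p (𝟙 K (B j) w))
                (𝟙-lookup (swap (B j) a b) w (lookup-swap-other (B j) w≢a w≢b)) ⟩
      change (x w) (𝟙 K (B j) w) (𝟙 K (B j) w)
        ≡⟨ solve 3 (λ y t p → y :+ (t :* p :- t :* p) := y) refl (x w) t (𝟙 K (B j) w) ⟩
      x w
        ≡⟨ transfer-other x t w≢a w≢b ⟨
      transfer x a b t w ∎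

  𝟙-bounds : ∀ {n} (B : Subset n) w → 0# ≤ 𝟙 K B w × 𝟙 K B w ≤ 1#
  𝟙-bounds B w with lookup B w
  ... | true  = 0≤1 , ≤-refl
  ... | false = ≤-refl , 0≤1

  combo-inUnitCube : ∀ {n m} {β : Fin m → Carrier} (B : Fin m → Subset n) →
    (∀ j → 0# ≤ β j) → sumFin m β ≡ 1# → InUnitCube (combo K β B)
  combo-inUnitCube {m = m} {β} B 0≤β Σβ≡1 w =
      sumFin-nonneg m (λ j → *-nonneg (0≤β j) (proj₁ (𝟙-bounds (B j) w)))
    , subst (combo K β B w ≤_) Σβ≡1 (sumFin-mono m λ j →
        subst (β j * 𝟙 K (B j) w ≤_) (*-identityʳ (β j))
          (*-monoʳ-≤ (0≤β j) (proj₂ (𝟙-bounds (B j) w))))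

  exchange-≥ : ∀ {n m} (f : Subset n → Carrier) → Submodular K f →
    ∀ (β : Fin m → Carrier) (B B′ : Fin m → Subset n) j {a b} → InUnitCube (combo K β B) →
    a ∉ B j → b ∈ B j → B′ j ≡ swap (B j) a b → (∀ i → i ≢ j → B′ i ≡ B i) →
    multilinear K f (combo K β B) + β j * (∂ f a (combo K β B) -ᶠ ∂ f b (combo K β B))
      ≤ multilinear K f (combo K β B′)
  exchange-≥ {n} f submodular β B B′ j {a} {b} cube a∉Bj b∈Bj B′j≡swap B′≡B = subst₂ _≤_
    (cong (_+ β j * (∂ f a x -ᶠ ∂ f b x)) (sym (multilinear≡ml f x)))
    (sym (trans (multilinear≡ml f (combo K β B′))
                (ml-cong f (combo-exchange β B B′ j a∉Bj b∈Bj B′j≡swap B′≡B))))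
    (ml-transfer-≥ f x (x∉p∧y∈p⇒x≢y a∉Bj b∈Bj) submodular cube (β j))
    where
    x : Vector Carrier n
    x = combo K β B

  mixture-identity : ∀ β₀ β₁ L e Δ → β₀ + β₁ ≢ 0# → L ≢ 0# →
    (β₁ ÷ (β₀ + β₁)) * ((L * e + β₀ * Δ) ÷ L)
      + (1# -ᶠ β₁ ÷ (β₀ + β₁)) * ((L * e + β₁ * - Δ) ÷ L) ≡ e
  mixture-identity β₀ β₁ L e Δ β₀+β₁≢0 L≢0 = begin
    (β₁ * s) * ((L * e + β₀ * Δ) * l) + (1# -ᶠ β₁ * s) * ((L * e + β₁ * - Δ) * l)
      ≡⟨ solve 7 (λ β₀ β₁ L e Δ s l →
           (β₁ :* s) :* ((L :* e :+ β₀ :* Δ) :* l) :+ (:1 :- β₁ :* s) :* ((L :* e :+ β₁ :* (:- Δ)) :* l)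
           := (L :* l) :* e :+ Δ :* l :* β₁ :* ((β₀ :+ β₁) :* s :- :1)) refl β₀ β₁ L e Δ s l ⟩
    (L * l) * e + Δ * l * β₁ * ((β₀ + β₁) * s -ᶠ 1#)
      ≡⟨ cong₂ (λ u v → u * e + Δ * l * β₁ * (v -ᶠ 1#))
               (⁻¹-inverse L L≢0) (⁻¹-inverse (β₀ + β₁) β₀+β₁≢0) ⟩
    1# * e + Δ * l * β₁ * (1# -ᶠ 1#)
      ≡⟨ solve 2 (λ e z → :1 :* e :+ z :* (:1 :- :1) := e) refl e (Δ * l * β₁) ⟩
    e ∎
    where
    open ≡-Reasoning
    s l : Carrier
    s = (β₀ + β₁) ⁻¹
    l = L ⁻¹

  mixture-≥ : ∀ {m β₀ β₁ e} {δ δ′ h h′ : Fin (suc m) → Carrier} →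
    0# ≤ β₀ → 0# ≤ β₁ → β₀ + β₁ ≢ 0# → sumFin (suc m) δ′ ≡ - sumFin (suc m) δ →
    (∀ i → e + β₀ * δ i ≤ h i) → (∀ i → e + β₁ * δ′ i ≤ h′ i) →
    e ≤ (β₁ ÷ (β₀ + β₁)) * (sumFin (suc m) h ÷ fromℕ (suc m))
        + (1# -ᶠ β₁ ÷ (β₀ + β₁)) * (sumFin (suc m) h′ ÷ fromℕ (suc m))
  mixture-≥ {m} {β₀} {β₁} {e} {δ} {δ′} {h} {h′} 0≤β₀ 0≤β₁ β₀+β₁≢0 Σδ′≡-Σδ gain gain′ = begin
    e
      ≡⟨ mixture-identity β₀ β₁ L e (sumFin (suc m) δ) β₀+β₁≢0 (fromℕ-suc≢0 m) ⟨
    p * ((L * e + β₀ * sumFin (suc m) δ) ÷ L) + (1# -ᶠ p) * ((L * e + β₁ * - sumFin (suc m) δ) ÷ L)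
      ≡⟨ cong₂ (λ u v → p * (u ÷ L) + (1# -ᶠ p) * (v ÷ L))
           (sumFin-affine (suc m) e β₀ δ)
           (trans (sumFin-affine (suc m) e β₁ δ′) (cong (λ Σ → L * e + β₁ * Σ) Σδ′≡-Σδ)) ⟨
    p * (sumFin (suc m) (λ i → e + β₀ * δ i) ÷ L)
      + (1# -ᶠ p) * (sumFin (suc m) (λ i → e + β₁ * δ′ i) ÷ L)
      ≤⟨ +-mono₂-≤ (weigh 0≤p (sumFin-mono (suc m) gain)) (weigh 0≤1-p (sumFin-mono (suc m) gain′)) ⟩
    p * (sumFin (suc m) h ÷ L) + (1# -ᶠ p) * (sumFin (suc m) h′ ÷ L) ∎
    where
    open ≤-Reasoning
    L s p : Carrier
    L = fromℕ (suc m)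
    s = (β₀ + β₁) ⁻¹
    p = β₁ ÷ (β₀ + β₁)
    0≤s : 0# ≤ s
    0≤s = ⁻¹-nonneg (+-nonneg 0≤β₀ 0≤β₁) β₀+β₁≢0
    0≤p : 0# ≤ p
    0≤p = *-nonneg 0≤β₁ 0≤s
    0≤1-p : 0# ≤ 1# -ᶠ p
    0≤1-p = subst (0# ≤_)
      (trans (solve 3 (λ β₀ β₁ s → β₀ :* s := (β₀ :+ β₁) :* s :- β₁ :* s) refl β₀ β₁ s)
             (cong (_-ᶠ p) (⁻¹-inverse (β₀ + β₁) β₀+β₁≢0)))
      (*-nonneg 0≤β₀ 0≤s)
    0≤L⁻¹ : 0# ≤ L ⁻¹
    0≤L⁻¹ = ⁻¹-nonneg (fromℕ-nonneg (suc m)) (fromℕ-suc≢0 m)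
    weigh : ∀ {w u v} → 0# ≤ w → u ≤ v → w * (u ÷ L) ≤ w * (v ÷ L)
    weigh 0≤w u≤v = *-monoʳ-≤ 0≤w (*-monoˡ-≤ 0≤L⁻¹ u≤v)

proposition14 : ∀ {c ℓ} (K : OrderedField c ℓ) {n s k : ℕ} (M : Matroid n)
    (β : Fin (suc (suc s)) → OrderedField.Carrier K)
    (B : Fin (suc (suc s)) → Subset n) →
    (∀ j → Matroid.IsBasis M (B j)) →
    (∀ j → OrderedField._≤_ K (OrderedField.0# K) (β j)) →
    OrderedField.sumFin K (suc (suc s)) β ≡ OrderedField.1# K →
    ¬ (OrderedField._+_ K (β zero) (β (suc zero)) ≡ OrderedField.0# K) →
    (C : ExchangeCycle M (B zero) (B (suc zero)) k) →
    (f : Subset n → OrderedField.Carrier K) → Submodular K f →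
    OrderedField._≤_ K
    (multilinear K f (combo K β B))
    (expectedAfterExchange K M (multilinear K f) β B C)
proposition14 K {n} {k = k} M β B _ 0≤β Σβ≡1 β₀+β₁≢0 C f submodular =
  mixture-≥ (0≤β zero) (0≤β (suc zero)) β₀+β₁≢0
    (sumFin-cycle k (λ i → ∂ f (v i) x) (λ i → ∂ f (u i) x))
    (λ i → exchange-≥ f submodular β B (set₁ B (swap (B zero) (v i) (u i))) zero
             cube (v∉B₁ i) (u∈B₁ i) refl (set₁-other B _))
    (λ i → exchange-≥ f submodular β B (set₂ B (swap (B (suc zero)) (u (next i)) (v i))) (suc zero)
             cube (u∉B₂ (next i)) (v∈B₂ i) refl (set₂-other B _))
  where
  open Exchange K
  open ExchangeCycle C
  open OrderedField K using (Carrier)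
  x : Vector Carrier n
  x = combo K β B
  cube : InUnitCube x
  cube = combo-inUnitCube B 0≤β Σβ≡1
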